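{- Let $\Omega$ be a finite set of size $n\ge3$. The minimal domination completions of $\mathcal{U}_{n-1,\Omega}$ are exactly the hypergraphs $\mathcal{D}(G)$ where $G$ is a disjoint union of stars with vertex set $\Omega$; that is, the set of minimal elements of $(\mathrm{Dom}(n-1,\Omega),\leqslant)$ equals $\{\mathcal{D}(G): G \text{ is a disjoint union of stars with vertex set }\Omega\}$.
   Context: Graphs are finite, simple, undirected; $\mathcal{D}(G)$ is the family of inclusion-minimal dominating sets of $G$ (a dominating set is $D\subseteq V(G)$ such that every vertex outside $D$ has a neighbour in $D$). A star is a tree of order $\ge2$ isomorphic to some $K_{1,m}$; a disjoint union of stars is a graph each of whose connected components is a star. A hypergraph on $\Omega$ is a nonempty family of nonempty subsets of $\Omega$, none a proper subset of another; it has ground set $\Omega$ if the union of its members is $\Omega$. A domination hypergraph is one of the form $\mathcal{D}(G)$. $\mathcal{U}_{r,\Omega}=\{A\subseteq\Omega:|A|=r\}$. $\mathcal{H}_1\leqslant\mathcal{H}_2$ means: for every $A_1\in\mathcal{H}_1$ there is $A_2\in\mathcal{H}_2$ with $A_2\subseteq A_1$. $\mathrm{Dom}(r,\Omega)$ is the set of domination hypergraphs with ground set $\Omega$ with $\mathcal{U}_{r,\Omega}\leqslant\mathcal{H}$. -}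

module Defs where

open import Data.Nat using (ℕ)
open import Data.Bool using (Bool; true; false)
open import Data.Fin using (Fin)
open import Data.Fin.Subset using (Subset; _∈_; _⊆_; ⊤)
open import Data.Product using (Σ; Σ-syntax; ∃; ∃-syntax; _×_; _,_)
open import Data.Sum using (_⊎_)
open import Relation.Nullary using (¬_)
open import Relation.Binary.PropositionalEquality using (_≡_; _≢_)
open import Function.Bundles using (_⇔_)
open import Level using (Level; 0ℓ) renaming (suc to lsuc)

record Graph (n : ℕ) : Set where
  field
    E     : Fin n → Fin n → Bool
    sym   : ∀ u v → E u v ≡ E v u
    irr   : ∀ v → E v v ≡ false
open Graph public

Adj : ∀ {n} → Graph n → Fin n → Fin n → Set
Adj G u v = E G u v ≡ true

IsDominating : ∀ {n} → Graph n → Subset n → Set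
IsDominating G D = ∀ v → ¬ (v ∈ D) → ∃[ u ] (u ∈ D × Adj G u v)

IsMinDominating : ∀ {n} → Graph n → Subset n → Set
IsMinDominating G D = IsDominating G D × (∀ D′ → D′ ⊆ D → IsDominating G D′ → D′ ≡ D)

Family : ℕ → Set₁
Family n = Subset n → Set

𝒟 : ∀ {n} → Graph n → Family n
𝒟 G = IsMinDominating G

_≋_ : ∀ {n} → Family n → Family n → Set
H₁ ≋ H₂ = ∀ A → H₁ A ⇔ H₂ A

_⩽_ : ∀ {n} → Family n → Family n → Set
H₁ ⩽ H₂ = ∀ A₁ → H₁ A₁ → ∃[ A₂ ] (H₂ A₂ × A₂ ⊆ A₁)

𝒰 : ∀ n → ℕ → Family n
𝒰 n r A = Data.Fin.Subset.∣ A ∣ ≡ r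

HasGroundSetΩ : ∀ {n} → Family n → Set
HasGroundSetΩ {n} H = ∀ (v : Fin n) → ∃[ A ] (H A × v ∈ A)

IsDominationHypergraph : ∀ {n} → Family n → Set
IsDominationHypergraph {n} H = ∃[ G ] (H ≋ 𝒟 {n} G)

InDom : ∀ n → ℕ → Family n → Set
InDom n r H = IsDominationHypergraph H × HasGroundSetΩ H × (𝒰 n r ⩽ H)

IsMinimalInDom : ∀ n → ℕ → Family n → Set₁
IsMinimalInDom n r H = InDom n r H × (∀ H′ → InDom n r H′ → H′ ⩽ H → H′ ≋ H)

data Reach {n} (G : Graph n) : Fin n → Fin n → Set where
  here : ∀ {v} → Reach G v v
  step : ∀ {u v w} → Adj G u v → Reach G v w → Reach G u w

-- The connected component of v (vertices reachable from v) induces a star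
-- K_{1,m}, m ≥ 1: it has a centre c, at least two vertices, and two vertices
-- x,y of the component are adjacent iff x ≠ y and one of them is c.
ComponentIsStar : ∀ {n} → Graph n → Fin n → Set
ComponentIsStar G v =
  (∃[ u ] (Reach G v u × u ≢ v)) ×
  (∃[ c ] (Reach G v c ×
     (∀ x y → Reach G v x → Reach G v y →
        (Adj G x y ⇔ (x ≢ y × (x ≡ c ⊎ y ≡ c))))))

IsDisjointUnionOfStars : ∀ {n} → Graph n → Set
IsDisjointUnionOfStars G = ∀ v → ComponentIsStar G v

-- Dom(n − 1, Ω) consists exactly of the 𝒟(G) with G free of isolated vertices,
-- because Ω ∖ {v} contains a minimal dominating set iff v has a neighbour.
-- For such a G, an edge-minimal spanning subgraph S without isolated vertices
-- has a leaf on every edge (deleting the edge isolates one of its ends), so S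
-- is a disjoint union of stars, and 𝒟(S) ⩽ 𝒟(G). Conversely, let G be a
-- disjoint union of stars and 𝒟(G′) ⩽ 𝒟(G) with G′ free of isolated vertices.
-- Then every dominating set of G′ dominates G. For an edge uv of G with u a
-- leaf, Ω ∖ {u, v} dominates G′ unless uv is an edge of G′, but it does not
-- dominate G; so G ⊆ G′, the two graphs have the same dominating sets, and
-- 𝒟(G′) = 𝒟(G).

module Submission where

open import Defs hiding (sym)
open import Data.Nat using (ℕ; _≤_; _<_; _∸_; _*_)
open import Data.Nat.Properties using (<-irrefl; module ≤-Reasoning)
open import Data.Bool using (Bool; true; false; not; _∧_; _∨_)
open import Data.Bool.Properties using (∨-comm; ∧-zeroʳ) renaming (_≟_ to _≟ᵇ_)
open import Data.Fin using (Fin; zero; suc; combine)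
open import Data.Fin.Properties using (_≟_; any?; all?; ¬∀⟶∃¬; combine-injective)
open import Data.Fin.Subset using (Subset; _∈_; _∉_; _⊆_; _⊂_; ⊤; _─_; _-_; ∣_∣; inside; outside)
open import Data.Fin.Subset.Properties
  using (_∈?_; ⊆-refl; ⊆-trans; ⊆-antisym; ∈⊤; ∣⊤∣≡n; x∈⁅x⁆; p─⊥≡p; p─q⊆p; p⊆q⇒∣p∣≤∣q∣;
         x∈p∧x≢y⇒x∈p-y; x∈p⇒p-x⊂p; x∈p⇒∣p-x∣<∣p∣)
open import Data.Fin.Subset.Induction using (Acc; acc; ⊂-wellFounded)
open import Data.Vec using (_∷_; lookup; tabulate; there)
open import Data.Vec.Properties using (lookup∘tabulate; []=⇒lookup; lookup⇒[]=)
open import Data.Product using (∃-syntax; _×_; _,_; proj₁; proj₂; swap)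
open import Data.Sum using (_⊎_; inj₁; inj₂)
import Data.Sum as Sum
open import Data.Empty using (⊥-elim)
open import Relation.Nullary using (¬_; Dec; yes; no; contradiction)
open import Relation.Nullary.Decidable using (_×-dec_; _→-dec_; ¬?; map′; decidable-stable)
open import Relation.Binary.PropositionalEquality using (_≡_; _≢_; refl; sym; trans; cong; cong₂; subst)
open import Function using (_∘_)
open import Function.Bundles using (_⇔_; mk⇔; Equivalence)
import Function.Properties.Equivalence as ⇔
open Equivalence using (to; from)

x∈p─q⇒x∉q : ∀ {n} {p q : Subset n} {x} → x ∈ p ─ q → x ∉ q
x∈p─q⇒x∉q {p = _ ∷ _} {inside  ∷ _} {zero} ()
x∈p─q⇒x∉q {p = _ ∷ _} {outside ∷ _} {zero} _ ()
x∈p─q⇒x∉q {p = _ ∷ _} {_ ∷ _} {suc x} (there x∈p─q) (there x∈q) = x∈p─q⇒x∉q x∈p─q x∈q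

x∈p-y⇒x≢y : ∀ {n} {p : Subset n} {x y} → x ∈ p - y → x ≢ y
x∈p-y⇒x≢y x∈p-x refl = x∈p─q⇒x∉q x∈p-x (x∈⁅x⁆ _)

x∉p-x : ∀ {n} {p : Subset n} {x} → x ∉ p - x
x∉p-x x∈p-x = x∈p-y⇒x≢y x∈p-x refl

∣⊤-x∣≡n∸1 : ∀ {n} (x : Fin n) → ∣ ⊤ - x ∣ ≡ n ∸ 1
∣⊤-x∣≡n∸1 {ℕ.suc n}         zero    = trans (cong ∣_∣ (p─⊥≡p (⊤ {n}))) (∣⊤∣≡n n)
∣⊤-x∣≡n∸1 {ℕ.suc (ℕ.suc n)} (suc x) = cong ℕ.suc (∣⊤-x∣≡n∸1 x)

∣A∣≡n∸1⇒⊤-v⊆A : ∀ {n} {A : Subset n} {v} → ∣ A ∣ ≡ n ∸ 1 → v ∉ A → ⊤ - v ⊆ A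
∣A∣≡n∸1⇒⊤-v⊆A {n} {A} {v} ∣A∣≡n∸1 v∉A {w} w∈⊤-v =
  decidable-stable (w ∈? A) (λ w∉A → <-irrefl refl (∣A∣<∣A∣ w∉A))
  where
  open ≤-Reasoning
  ∣A∣<∣A∣ : w ∉ A → ∣ A ∣ < ∣ A ∣
  ∣A∣<∣A∣ w∉A = begin-strict
    ∣ A ∣         ≤⟨ p⊆q⇒∣p∣≤∣q∣ A⊆⊤-v-w ⟩
    ∣ ⊤ - v - w ∣ <⟨ x∈p⇒∣p-x∣<∣p∣ w∈⊤-v ⟩
    ∣ ⊤ - v ∣     ≡⟨ ∣⊤-x∣≡n∸1 v ⟩
    n ∸ 1         ≡⟨ sym ∣A∣≡n∸1 ⟩
    ∣ A ∣         ∎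
    where
    A⊆⊤-v-w : A ⊆ ⊤ - v - w
    A⊆⊤-v-w y∈A = x∈p∧x≢y⇒x∈p-y (x∈p∧x≢y⇒x∈p-y ∈⊤ (λ { refl → v∉A y∈A })) (λ { refl → w∉A y∈A })

∈-tabulate⁺ : ∀ {n} (f : Fin n → Bool) {i} → f i ≡ true → i ∈ tabulate f
∈-tabulate⁺ f {i} fi≡true = lookup⇒[]= i (tabulate f) (trans (lookup∘tabulate f i) fi≡true)

∈-tabulate⁻ : ∀ {n} (f : Fin n → Bool) {i} → i ∈ tabulate f → f i ≡ true
∈-tabulate⁻ f {i} i∈ = trans (sym (lookup∘tabulate f i)) ([]=⇒lookup i∈)

LocallyMinimal : ∀ {m} → (Subset m → Set) → Subset m → Set
LocallyMinimal P q = P q × (∀ i → i ∈ q → ¬ P (q - i))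

locallyMinimal-⊆ : ∀ {m} {P : Subset m → Set} → (∀ p → Dec (P p)) →
                   ∀ {p} → P p → ∃[ q ] (q ⊆ p × LocallyMinimal P q)
locallyMinimal-⊆ {P = P} P? {p} = go p (⊂-wellFounded p)
  where
  go : ∀ p → Acc _⊂_ p → P p → ∃[ q ] (q ⊆ p × LocallyMinimal P q)
  go p (acc smaller) Pp with any? (λ i → (i ∈? p) ×-dec P? (p - i))
  ... | yes (i , i∈p , P[p-i]) =
    let q , q⊆p-i , q-min = go (p - i) (smaller (x∈p⇒p-x⊂p i∈p)) P[p-i]
    in  q , ⊆-trans q⊆p-i (p─q⊆p p _) , q-min
  ... | no ¬removable = p , ⊆-refl , Pp , λ i i∈p P[p-i] → ¬removable (i , i∈p , P[p-i])

locallyMinimal⇒minimal : ∀ {m} {P : Subset m → Set} → (∀ {p q} → P p → p ⊆ q → P q) →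
                         ∀ {q} → LocallyMinimal P q → ∀ q′ → q′ ⊆ q → P q′ → q′ ≡ q
locallyMinimal⇒minimal upward {q} (_ , q-min) q′ q′⊆q Pq′ = ⊆-antisym q′⊆q q⊆q′
  where
  q⊆q′ : q ⊆ q′
  q⊆q′ {x} x∈q = decidable-stable (x ∈? q′) λ x∉q′ →
    q-min x x∈q (upward Pq′ (λ y∈q′ → x∈p∧x≢y⇒x∈p-y (q′⊆q y∈q′) (λ { refl → x∉q′ y∈q′ })))

NoIsolatedVertex : ∀ {n} → Graph n → Set
NoIsolatedVertex G = ∀ v → ∃[ u ] Adj G v u

AtMostOneNeighbour : ∀ {n} → Graph n → Fin n → Set
AtMostOneNeighbour G x = ∀ {y z} → Adj G x y → Adj G x z → y ≡ z

EveryEdgeHasLeaf : ∀ {n} → Graph n → Set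
EveryEdgeHasLeaf G = ∀ {u v} → Adj G u v → AtMostOneNeighbour G u ⊎ AtMostOneNeighbour G v

Subgraph : ∀ {n} → Graph n → Graph n → Set
Subgraph G G′ = ∀ {u v} → Adj G u v → Adj G′ u v

module _ {n} (G : Graph n) where

  Adj-sym : ∀ {u v} → Adj G u v → Adj G v u
  Adj-sym {u} {v} uv = trans (Graph.sym G v u) uv

  Adj⇒≢ : ∀ {u v} → Adj G u v → u ≢ v
  Adj⇒≢ {u} u~u refl with trans (sym u~u) (irr G u)
  ... | ()

  Adj? : ∀ u v → Dec (Adj G u v)
  Adj? u v = E G u v ≟ᵇ true

  AtMostOneNeighbour? : ∀ x → Dec (AtMostOneNeighbour G x)
  AtMostOneNeighbour? x = map′ (λ unique {y} {z} → unique y z) (λ unique y z → unique)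
    (all? (λ y → all? (λ z → Adj? x y →-dec (Adj? x z →-dec (y ≟ z)))))

  onlyNeighbour⇒atMostOne : ∀ {x w} → (∀ {y} → Adj G x y → y ≡ w) → AtMostOneNeighbour G x
  onlyNeighbour⇒atMostOne only xy xz = trans (only xy) (sym (only xz))

  NoIsolatedVertex? : Dec (NoIsolatedVertex G)
  NoIsolatedVertex? = all? (λ v → any? (Adj? v))

  incidentOnlyTo⇒leaf : ∀ {x u v y₀} → (∀ {y} → Adj G x y → (x ≡ u × y ≡ v) ⊎ (x ≡ v × y ≡ u)) →
                        Adj G x y₀ → AtMostOneNeighbour G u ⊎ AtMostOneNeighbour G v
  incidentOnlyTo⇒leaf {x} {u} {v} only xy₀ = Sum.map
    (λ (x≡u , _) → subst (AtMostOneNeighbour G) x≡u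
                     (onlyNeighbour⇒atMostOne {x} {v} (λ xy → proj₁ (partner xy) x≡u)))
    (λ (x≡v , _) → subst (AtMostOneNeighbour G) x≡v
                     (onlyNeighbour⇒atMostOne {x} {u} (λ xy → proj₂ (partner xy) x≡v)))
    (only xy₀)
    where
    partner : ∀ {y} → Adj G x y → (x ≡ u → y ≡ v) × (x ≡ v → y ≡ u)
    partner xy with only xy
    ... | inj₁ (x≡u , y≡v) = (λ _ → y≡v) , (λ x≡v → trans y≡v (trans (sym x≡v) x≡u))
    ... | inj₂ (x≡v , y≡u) = (λ x≡u → trans y≡u (trans (sym x≡u) x≡v)) , (λ _ → y≡u)

  IsDominating? : ∀ D → Dec (IsDominating G D)
  IsDominating? D = all? (λ v → ¬? (v ∈? D) →-dec any? (λ u → (u ∈? D) ×-dec Adj? u v))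

  dominating-⊆ : ∀ {A B} → IsDominating G A → A ⊆ B → IsDominating G B
  dominating-⊆ A-dom A⊆B v v∉B =
    let u , u∈A , uv = A-dom v (λ v∈A → v∉B (A⊆B v∈A)) in u , A⊆B u∈A , uv

  minimalDominating-⊆ : ∀ {D} → IsDominating G D → ∃[ M ] (M ⊆ D × 𝒟 G M)
  minimalDominating-⊆ D-dom =
    let M , M⊆D , M-min = locallyMinimal-⊆ IsDominating? D-dom
    in  M , M⊆D , proj₁ M-min , locallyMinimal⇒minimal dominating-⊆ M-min

  -- v together with its non-neighbours dominates G, and every minimal
  -- dominating set inside it must keep v.
  minimalDominating-∋ : ∀ v → ∃[ M ] (𝒟 G M × v ∈ M)
  minimalDominating-∋ v =
    let M , M⊆ , M-min = minimalDominating-⊆ nonNeighbours-dom in M , M-min , v∈M M⊆ M-min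
    where
    nonAdjacent : Fin n → Bool
    nonAdjacent x = not (E G v x)

    nonNeighbours-dom : IsDominating G (tabulate nonAdjacent)
    nonNeighbours-dom x x∉ with E G v x in vx
    ... | true  = v , ∈-tabulate⁺ nonAdjacent (cong not (irr G v)) , vx
    ... | false = ⊥-elim (x∉ (∈-tabulate⁺ nonAdjacent (cong not vx)))

    nonNeighbour⇒¬Adj : ∀ {x} → x ∈ tabulate nonAdjacent → ¬ Adj G v x
    nonNeighbour⇒¬Adj x∈ vx with trans (cong not (sym vx)) (∈-tabulate⁻ nonAdjacent x∈)
    ... | ()

    v∈M : ∀ {M} → M ⊆ tabulate nonAdjacent → 𝒟 G M → v ∈ M
    v∈M M⊆ (M-dom , _) = decidable-stable (v ∈? _) λ v∉M →
      let u , u∈M , uv = M-dom v v∉M in nonNeighbour⇒¬Adj (M⊆ u∈M) (Adj-sym uv)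

≋-refl : ∀ {n} {H : Family n} → H ≋ H
≋-refl A = ⇔.refl

≋-sym : ∀ {n} {H H′ : Family n} → H ≋ H′ → H′ ≋ H
≋-sym H≋H′ A = ⇔.sym (H≋H′ A)

≋-trans : ∀ {n} {H H′ H″ : Family n} → H ≋ H′ → H′ ≋ H″ → H ≋ H″
≋-trans H≋H′ H′≋H″ A = ⇔.trans (H≋H′ A) (H′≋H″ A)

⩽-resp-≋ : ∀ {n} {H₁ H₁′ H₂ H₂′ : Family n} → H₁ ≋ H₁′ → H₂ ≋ H₂′ → H₁ ⩽ H₂ → H₁′ ⩽ H₂′
⩽-resp-≋ H₁≋ H₂≋ H₁⩽H₂ A₁ A₁∈ =
  let A₂ , A₂∈ , A₂⊆A₁ = H₁⩽H₂ A₁ (from (H₁≋ A₁) A₁∈) in A₂ , to (H₂≋ A₂) A₂∈ , A₂⊆A₁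

module _ {n} (G G′ : Graph n) where

  subgraph⇒dominating : Subgraph G G′ → ∀ {D} → IsDominating G D → IsDominating G′ D
  subgraph⇒dominating G⊆G′ D-dom v v∉D = let u , u∈D , uv = D-dom v v∉D in u , u∈D , G⊆G′ uv

  sameDominating⇒𝒟≋ : (∀ D → IsDominating G D ⇔ IsDominating G′ D) → 𝒟 G ≋ 𝒟 G′
  sameDominating⇒𝒟≋ same A = mk⇔
    (λ (A-dom , A-min) → to (same A) A-dom , λ D D⊆A D-dom → A-min D D⊆A (from (same D) D-dom))
    (λ (A-dom , A-min) → from (same A) A-dom , λ D D⊆A D-dom → A-min D D⊆A (to (same D) D-dom))

  subgraph⇒𝒟⩽𝒟 : Subgraph G G′ → 𝒟 G ⩽ 𝒟 G′
  subgraph⇒𝒟⩽𝒟 G⊆G′ A (A-dom , _) =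
    let M , M⊆A , M-min = minimalDominating-⊆ G′ (subgraph⇒dominating G⊆G′ A-dom) in M , M-min , M⊆A

  𝒟⩽𝒟⇒dominating : 𝒟 G′ ⩽ 𝒟 G → ∀ {D} → IsDominating G′ D → IsDominating G D
  𝒟⩽𝒟⇒dominating 𝒟G′⩽𝒟G D-dom =
    let M , M⊆D , M-min = minimalDominating-⊆ G′ D-dom
        A , (A-dom , _) , A⊆M = 𝒟G′⩽𝒟G M M-min
    in  dominating-⊆ G A-dom (⊆-trans A⊆M M⊆D)

-- Dom(n − 1, Ω)

𝒰⩽𝒟 : ∀ {n} (G : Graph n) → NoIsolatedVertex G → 𝒰 n (n ∸ 1) ⩽ 𝒟 G
𝒰⩽𝒟 G noIsolated A ∣A∣≡n∸1 =
  let M , M⊆A , M-min = minimalDominating-⊆ G A-dom in M , M-min , M⊆A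
  where
  A-dom : IsDominating G A
  A-dom v v∉A =
    let u , vu = noIsolated v
    in  u , ∣A∣≡n∸1⇒⊤-v⊆A ∣A∣≡n∸1 v∉A (x∈p∧x≢y⇒x∈p-y ∈⊤ (Adj⇒≢ G (Adj-sym G vu))) , Adj-sym G vu

𝒰⩽𝒟⇒noIsolated : ∀ {n} (G : Graph n) → 𝒰 n (n ∸ 1) ⩽ 𝒟 G → NoIsolatedVertex G
𝒰⩽𝒟⇒noIsolated G 𝒰⩽ v =
  let A , (A-dom , _) , A⊆⊤-v = 𝒰⩽ (⊤ - v) (∣⊤-x∣≡n∸1 v)
      u , _ , uv = A-dom v (λ v∈A → x∉p-x (A⊆⊤-v v∈A))
  in  u , Adj-sym G uv

InDom⇔𝒟-noIsolated : ∀ {n} {H : Family n} →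
                     InDom n (n ∸ 1) H ⇔ (∃[ G ] (NoIsolatedVertex G × (H ≋ 𝒟 G)))
InDom⇔𝒟-noIsolated = mk⇔
  (λ ((G , H≋) , _ , 𝒰⩽H) → G , 𝒰⩽𝒟⇒noIsolated G (⩽-resp-≋ ≋-refl H≋ 𝒰⩽H) , H≋)
  (λ (G , noIsolated , H≋) →
     (G , H≋) ,
     (λ v → let A , A-min , v∈A = minimalDominating-∋ G v in A , from (H≋ A) A-min , v∈A) ,
     ⩽-resp-≋ ≋-refl (≋-sym H≋) (𝒰⩽𝒟 G noIsolated))

module _ {n} (G G′ : Graph n) (noIsolated′ : NoIsolatedVertex G′)
         (dom′⇒dom : ∀ {D} → IsDominating G′ D → IsDominating G D) where

  leafEdge-preserved : ∀ {u v} → AtMostOneNeighbour G u → Adj G u v → Adj G′ u v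
  leafEdge-preserved {u} {v} u-leaf uv with Adj? G′ u v
  ... | yes u~v = u~v
  ... | no u≁v =
    let y , y∈D , yu = dom′⇒dom D-dom u (λ u∈D → x∉p-x (p─q⊆p _ _ u∈D))
    in  contradiction (u-leaf (Adj-sym G yu) uv) (x∈p-y⇒x≢y y∈D)
    where
    D : Subset n
    D = ⊤ - u - v
    ∈D : ∀ {x} → x ≢ u → x ≢ v → x ∈ D
    ∈D x≢u x≢v = x∈p∧x≢y⇒x∈p-y (x∈p∧x≢y⇒x∈p-y ∈⊤ x≢u) x≢v
    ∉D⇒endpoint : ∀ {x} → x ∉ D → x ≡ u ⊎ x ≡ v
    ∉D⇒endpoint {x} x∉D with x ≟ u | x ≟ v
    ... | yes x≡u | _       = inj₁ x≡u
    ... | no _    | yes x≡v = inj₂ x≡v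
    ... | no x≢u  | no x≢v  = ⊥-elim (x∉D (∈D x≢u x≢v))
    neighbour-∈D : ∀ {x y} → x ≡ u ⊎ x ≡ v → Adj G′ x y → y ∈ D
    neighbour-∈D (inj₁ refl) xy = ∈D (λ { refl → Adj⇒≢ G′ xy refl }) (λ { refl → u≁v xy })
    neighbour-∈D (inj₂ refl) xy = ∈D (λ { refl → u≁v (Adj-sym G′ xy) }) (λ { refl → Adj⇒≢ G′ xy refl })
    D-dom : IsDominating G′ D
    D-dom x x∉D = let y , xy = noIsolated′ x in y , neighbour-∈D (∉D⇒endpoint x∉D) xy , Adj-sym G′ xy

  everyEdgeHasLeaf⇒𝒟-minimal : EveryEdgeHasLeaf G → 𝒟 G′ ≋ 𝒟 G
  everyEdgeHasLeaf⇒𝒟-minimal leafEdged =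
    ≋-sym (sameDominating⇒𝒟≋ G G′ (λ D → mk⇔ (subgraph⇒dominating G G′ G⊆G′) dom′⇒dom))
    where
    G⊆G′ : Subgraph G G′
    G⊆G′ uv with leafEdged uv
    ... | inj₁ u-leaf = leafEdge-preserved u-leaf uv
    ... | inj₂ v-leaf = Adj-sym G′ (leafEdge-preserved v-leaf (Adj-sym G uv))

-- Disjoint unions of stars

IsStarCentre : ∀ {n} → Graph n → Fin n → Set
IsStarCentre G c = ∀ {x} → Adj G c x → AtMostOneNeighbour G x

StarShaped : ∀ {n} → Graph n → Fin n → Fin n → Set
StarShaped G v c = ∀ x y → Reach G v x → Reach G v y → Adj G x y ⇔ (x ≢ y × (x ≡ c ⊎ y ≡ c))

module _ {n} (G : Graph n) where

  reach-neighbour : ∀ {v u} → Reach G v u → u ≢ v → ∃[ w ] Adj G v w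
  reach-neighbour here        u≢u = ⊥-elim (u≢u refl)
  reach-neighbour (step vw _) _   = _ , vw

  reach-snoc : ∀ {u v w} → Reach G u v → Adj G v w → Reach G u w
  reach-snoc here        vw = step vw here
  reach-snoc (step uv r) vw = step uv (reach-snoc r vw)

  nonCentre⇒leaf : ∀ {v c} → StarShaped G v c → ∀ {x} → Reach G v x → x ≢ c → AtMostOneNeighbour G x
  nonCentre⇒leaf {c = c} star {x} v↝x x≢c = onlyNeighbour⇒atMostOne G neighbour≡c
    where
    neighbour≡c : ∀ {y} → Adj G x y → y ≡ c
    neighbour≡c xy with proj₂ (to (star _ _ v↝x (reach-snoc v↝x xy)) xy)
    ... | inj₁ x≡c = ⊥-elim (x≢c x≡c)
    ... | inj₂ y≡c = y≡c

  starUnion⇒noIsolated : IsDisjointUnionOfStars G → NoIsolatedVertex G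
  starUnion⇒noIsolated stars v = let (u , v↝u , u≢v) , _ = stars v in reach-neighbour v↝u u≢v

  starUnion⇒everyEdgeHasLeaf : IsDisjointUnionOfStars G → EveryEdgeHasLeaf G
  starUnion⇒everyEdgeHasLeaf stars {u} {v} uv with stars u
  ... | _ , c , _ , star with proj₂ (to (star u v here (step uv here)) uv)
  ...   | inj₁ u≡c = inj₂ (nonCentre⇒leaf star (step uv here) (λ v≡c → Adj⇒≢ G uv (trans u≡c (sym v≡c))))
  ...   | inj₂ v≡c = inj₁ (nonCentre⇒leaf star here (λ u≡c → Adj⇒≢ G uv (trans u≡c (sym v≡c))))

  InStar : Fin n → Fin n → Set
  InStar c x = x ≡ c ⊎ Adj G c x

  module _ {c} (centre : IsStarCentre G c) where

    InStar-reach : ∀ {x y} → InStar c x → Reach G x y → InStar c y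
    InStar-reach x∈       here                = x∈
    InStar-reach (inj₁ refl) (step cy y↝z)  = InStar-reach (inj₂ cy) y↝z
    InStar-reach (inj₂ cx)   (step xy y↝z)  = InStar-reach (inj₁ (centre cx xy (Adj-sym G cx))) y↝z

    InStar-starShaped : ∀ {x y} → InStar c x → InStar c y → Adj G x y ⇔ (x ≢ y × (x ≡ c ⊎ y ≡ c))
    InStar-starShaped x∈ y∈ = mk⇔ (λ xy → Adj⇒≢ G xy , centre-endpoint x∈ xy) (edge x∈ y∈)
      where
      centre-endpoint : ∀ {x y} → InStar c x → Adj G x y → x ≡ c ⊎ y ≡ c
      centre-endpoint (inj₁ x≡c) _  = inj₁ x≡c
      centre-endpoint (inj₂ cx)  xy = inj₂ (centre cx xy (Adj-sym G cx))
      edge : ∀ {x y} → InStar c x → InStar c y → x ≢ y × (x ≡ c ⊎ y ≡ c) → Adj G x y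
      edge _         (inj₁ refl) (x≢c , inj₁ refl) = ⊥-elim (x≢c refl)
      edge _         (inj₂ cy)   (_   , inj₁ refl) = cy
      edge (inj₁ refl) _         (c≢y , inj₂ refl) = ⊥-elim (c≢y refl)
      edge (inj₂ cx)   _         (_   , inj₂ refl) = Adj-sym G cx

  module _ (leafEdged : EveryEdgeHasLeaf G) where

    nonLeaf⇒starCentre : ∀ {c} → ¬ AtMostOneNeighbour G c → IsStarCentre G c
    nonLeaf⇒starCentre ¬c-leaf cx with leafEdged cx
    ... | inj₁ c-leaf = ⊥-elim (¬c-leaf c-leaf)
    ... | inj₂ x-leaf = x-leaf

    -- If v and its neighbour w are both leaves, their component is the edge vw
    -- and w serves as centre.
    starCentre-near : NoIsolatedVertex G → ∀ v → ∃[ c ] (InStar c v × IsStarCentre G c)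
    starCentre-near noIsolated v with AtMostOneNeighbour? G v
    ... | no ¬v-leaf = v , inj₁ refl , nonLeaf⇒starCentre ¬v-leaf
    ... | yes v-leaf with noIsolated v
    ...   | w , vw with AtMostOneNeighbour? G w
    ...     | no ¬w-leaf = w , inj₂ (Adj-sym G vw) , nonLeaf⇒starCentre ¬w-leaf
    ...     | yes w-leaf = w , inj₂ (Adj-sym G vw) ,
                           λ wx → subst (AtMostOneNeighbour G) (w-leaf (Adj-sym G vw) wx) v-leaf

    everyEdgeHasLeaf⇒starUnion : NoIsolatedVertex G → IsDisjointUnionOfStars G
    everyEdgeHasLeaf⇒starUnion noIsolated v with noIsolated v | starCentre-near noIsolated v
    ... | w , vw | c , v∈ , centre =
      (w , step vw here , λ w≡v → Adj⇒≢ G vw (sym w≡v)) ,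
      c , reach-centre v∈ ,
      λ x y v↝x v↝y → InStar-starShaped centre (InStar-reach centre v∈ v↝x)
                                               (InStar-reach centre v∈ v↝y)
      where
      reach-centre : ∀ {c v} → InStar c v → Reach G v c
      reach-centre (inj₁ refl) = here
      reach-centre (inj₂ cv)   = step (Adj-sym G cv) here

-- Edge-minimal spanning subgraphs without isolated vertices

∨-∧≡true⇔ : ∀ {a b c} → ((a ∨ b) ∧ c ≡ true) ⇔ ((a ≡ true ⊎ b ≡ true) × c ≡ true)
∨-∧≡true⇔ {true}  {_}     {true}  = mk⇔ (λ _ → inj₁ refl , refl) (λ _ → refl)
∨-∧≡true⇔ {true}  {_}     {false} = mk⇔ (λ ()) (λ ())
∨-∧≡true⇔ {false} {true}  {true}  = mk⇔ (λ _ → inj₂ refl , refl) (λ _ → refl)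
∨-∧≡true⇔ {false} {true}  {false} = mk⇔ (λ ()) (λ ())
∨-∧≡true⇔ {false} {false} {_}     = mk⇔ (λ ()) (λ { (inj₁ () , _) ; (inj₂ () , _) })

-- restrict F keeps the edge uv of G iff combine u v or combine v u lies in F.
module EdgeSelection {n} (G : Graph n) where

  Selected : Subset (n * n) → Fin n → Fin n → Set
  Selected F u v = combine u v ∈ F ⊎ combine v u ∈ F

  restrict : Subset (n * n) → Graph n
  restrict F = record
    { E   = λ u v → (lookup F (combine u v) ∨ lookup F (combine v u)) ∧ E G u v
    ; sym = λ u v → cong₂ _∧_ (∨-comm (lookup F (combine u v)) _) (Graph.sym G u v)
    ; irr = λ v → trans (cong (_ ∧_) (irr G v)) (∧-zeroʳ _)
    }

  Adj-restrict : ∀ {F u v} → Adj (restrict F) u v ⇔ (Selected F u v × Adj G u v)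
  Adj-restrict {F} = mk⇔
    (λ uv → let selected , uv = to ∨-∧≡true⇔ uv in
              Sum.map (lookup⇒[]= _ F) (lookup⇒[]= _ F) selected , uv)
    (λ (selected , uv) → from ∨-∧≡true⇔ (Sum.map []=⇒lookup []=⇒lookup selected , uv))

  restrict-⊆ : ∀ F → Subgraph (restrict F) G
  restrict-⊆ F uv = proj₂ (to (Adj-restrict {F}) uv)

  ⊆-restrict-⊤ : Subgraph G (restrict ⊤)
  ⊆-restrict-⊤ uv = from (Adj-restrict {⊤}) (inj₁ ∈⊤ , uv)

  restrict-removed : ∀ {F i x y} → Adj (restrict F) x y → ¬ Adj (restrict (F - i)) x y →
                     combine x y ≡ i ⊎ combine y x ≡ i
  restrict-removed {F} {i} {x} {y} xy ¬xy with combine x y ≟ i | combine y x ≟ i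
  ... | yes xy≡i | _        = inj₁ xy≡i
  ... | no _     | yes yx≡i = inj₂ yx≡i
  ... | no xy≢i  | no yx≢i  = ⊥-elim (¬xy (from Adj-restrict (still-selected , restrict-⊆ F xy)))
    where
    still-selected : Selected (F - i) x y
    still-selected = Sum.map (λ xy∈F → x∈p∧x≢y⇒x∈p-y xy∈F xy≢i) (λ yx∈F → x∈p∧x≢y⇒x∈p-y yx∈F yx≢i)
                             (proj₁ (to Adj-restrict xy))

  EdgeMinimal : Subset (n * n) → Set
  EdgeMinimal = LocallyMinimal (λ F → NoIsolatedVertex (restrict F))

  edgeMinimal⇒leaf : ∀ {F} → EdgeMinimal F → ∀ {u v} → Adj (restrict F) u v → combine u v ∈ F →
                     AtMostOneNeighbour (restrict F) u ⊎ AtMostOneNeighbour (restrict F) v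
  edgeMinimal⇒leaf {F} (noIsolated , F-min) {u} {v} uv uv∈F =
    let x , x-isolated = ¬∀⟶∃¬ n _ (λ x → any? (Adj? (restrict (F - combine u v)) x)) (F-min _ uv∈F)
        _ , xy₀ = noIsolated x
    in  incidentOnlyTo⇒leaf (restrict F)
          (λ xy → endpoints (restrict-removed {F} {combine u v} xy (λ xy′ → x-isolated (_ , xy′)))) xy₀
    where
    endpoints : ∀ {x y} → combine x y ≡ combine u v ⊎ combine y x ≡ combine u v →
                (x ≡ u × y ≡ v) ⊎ (x ≡ v × y ≡ u)
    endpoints = Sum.map (combine-injective _ _ _ _) (swap ∘ combine-injective _ _ _ _)

  edgeMinimal⇒everyEdgeHasLeaf : ∀ {F} → EdgeMinimal F → EveryEdgeHasLeaf (restrict F)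
  edgeMinimal⇒everyEdgeHasLeaf {F} F-min uv with proj₁ (to (Adj-restrict {F}) uv)
  ... | inj₁ uv∈F = edgeMinimal⇒leaf {F} F-min uv uv∈F
  ... | inj₂ vu∈F = Sum.swap (edgeMinimal⇒leaf {F} F-min (Adj-sym (restrict F) uv) vu∈F)

  spanningLeafEdgedSubgraph : NoIsolatedVertex G →
                              ∃[ S ] (Subgraph S G × NoIsolatedVertex S × EveryEdgeHasLeaf S)
  spanningLeafEdgedSubgraph noIsolated =
    let F , _ , F-min = locallyMinimal-⊆ (λ F → NoIsolatedVertex? (restrict F)) {⊤} noIsolated-⊤
    in  restrict F , restrict-⊆ F , proj₁ F-min , edgeMinimal⇒everyEdgeHasLeaf {F} F-min
    where
    noIsolated-⊤ : NoIsolatedVertex (restrict ⊤)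
    noIsolated-⊤ v = let u , vu = noIsolated v in u , ⊆-restrict-⊤ vu

open EdgeSelection using (spanningLeafEdgedSubgraph)

theorem4p8 : ∀ (n : ℕ) → 3 ≤ n → (H : Family n) →
    IsMinimalInDom n (n ∸ 1) H ⇔ (∃[ G ] (IsDisjointUnionOfStars G × (H ≋ 𝒟 G)))
theorem4p8 n _ H = mk⇔ minimal⇒starUnion starUnion⇒minimal
  where
  minimal⇒starUnion : IsMinimalInDom n (n ∸ 1) H → ∃[ G ] (IsDisjointUnionOfStars G × (H ≋ 𝒟 G))
  minimal⇒starUnion (H∈Dom , H-minimal) =
    let G₀ , noIsolated₀ , H≋𝒟G₀ = to InDom⇔𝒟-noIsolated H∈Dom
        G , G⊆G₀ , noIsolated , leafEdged = spanningLeafEdgedSubgraph G₀ noIsolated₀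
        𝒟G∈Dom = from InDom⇔𝒟-noIsolated (G , noIsolated , ≋-refl)
        𝒟G⩽H = ⩽-resp-≋ ≋-refl (≋-sym H≋𝒟G₀) (subgraph⇒𝒟⩽𝒟 G G₀ G⊆G₀)
    in  G , everyEdgeHasLeaf⇒starUnion G leafEdged noIsolated , ≋-sym (H-minimal (𝒟 G) 𝒟G∈Dom 𝒟G⩽H)

  starUnion⇒minimal : ∃[ G ] (IsDisjointUnionOfStars G × (H ≋ 𝒟 G)) → IsMinimalInDom n (n ∸ 1) H
  starUnion⇒minimal (G , stars , H≋𝒟G) =
    from InDom⇔𝒟-noIsolated (G , starUnion⇒noIsolated G stars , H≋𝒟G) , λ H′ H′∈Dom H′⩽H →
      let G′ , noIsolated′ , H′≋𝒟G′ = to InDom⇔𝒟-noIsolated H′∈Dom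
          dom′⇒dom = 𝒟⩽𝒟⇒dominating G G′ (⩽-resp-≋ H′≋𝒟G′ H≋𝒟G H′⩽H)
          𝒟G′≋𝒟G = everyEdgeHasLeaf⇒𝒟-minimal G G′ noIsolated′ dom′⇒dom
                      (starUnion⇒everyEdgeHasLeaf G stars)
      in  ≋-trans H′≋𝒟G′ (≋-trans 𝒟G′≋𝒟G (≋-sym H≋𝒟G))
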